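{- There are no integers, and no rational numbers, $x_1,x_2,x_3,d_1,d_2,d_3,L$ with $\operatorname{rank}N_1=1$ and $\operatorname{rank}N_2=2$ that satisfy the eight factor equations $\tilde p_1=\tilde p_2=\tilde p_3=\tilde p_4=\tilde p_5=\tilde p_6=\tilde p_7=\tilde p_8=0$; likewise there are none with $\operatorname{rank}N_1=1$ and $\operatorname{rank}N_2=2$ satisfying the equations $p_0=p_1=p_2=p_3=0$.
   Context: Define $p_0=x_1^2+x_2^2+x_3^2-L^2$, $p_1=x_2^2+x_3^2-d_1^2$, $p_2=x_3^2+x_1^2-d_2^2$, $p_3=x_1^2+x_2^2-d_3^2$, and $\tilde p_1=p_0$, $\tilde p_2=p_1+p_2+p_3$, $\tilde p_3=\sum_i d_ip_i$, $\tilde p_4=\sum_i x_ip_i$, $\tilde p_5=\sum_i x_id_ip_i$, $\tilde p_6=\sum_i x_i^2p_i$, $\tilde p_7=\sum_i d_i^2p_i$, $\tilde p_8=\sum_i x_i^2d_i^2p_i$ (sums over $i=1,2,3$). $N_1$ is the $3\times2$ matrix with rows $(1,d_i)$, $i=1,2,3$, and $N_2$ is the $3\times 2$ matrix with rows $(1,x_i)$, $i=1,2,3$. -}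

module Defs where

open import Data.Nat using (ℕ)
open import Data.Bool using (Bool; true; false; _∨_; if_then_else_)
open import Data.Fin using (Fin; zero; suc)
open import Data.Product using (Σ; _×_; _,_)
open import Relation.Nullary using (¬_; does)
open import Relation.Binary.PropositionalEquality using (_≡_)
open import Relation.Binary.Definitions using (DecidableEquality)
import Data.Integer as ℤ
import Data.Integer.Properties as ℤP
import Data.Rational as ℚ
import Data.Rational.Properties as ℚP

module Generic {A : Set} (0# 1# : A) (add mul sub : A → A → A)
                (_≟_ : DecidableEquality A) where

  infixl 6 _+_ _-_
  infixl 7 _*_

  _+_ _*_ _-_ : A → A → A
  _+_ = add
  _*_ = mul
  _-_ = sub

  sq : A → A
  sq a = a * a

  Mat32 : Set
  Mat32 = Fin 3 → Fin 2 → A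

  minor : Mat32 → Fin 3 → Fin 3 → A
  minor M i k = M i zero * M k (suc zero) - M i (suc zero) * M k zero

  nonzero : A → Bool
  nonzero a = if does (a ≟ 0#) then false else true

  rank : Mat32 → ℕ
  rank M =
    if nonzero (minor M zero (suc zero)) ∨ nonzero (minor M zero (suc (suc zero)))
       ∨ nonzero (minor M (suc zero) (suc (suc zero)))
    then 2
    else (if nonzero (M zero zero) ∨ nonzero (M zero (suc zero))
             ∨ nonzero (M (suc zero) zero) ∨ nonzero (M (suc zero) (suc zero))
             ∨ nonzero (M (suc (suc zero)) zero) ∨ nonzero (M (suc (suc zero)) (suc zero))
          then 1 else 0)

  -- N₁ has rows (1, d_i); N₂ has rows (1, x_i)
  N : (Fin 3 → A) → Mat32
  N v i zero = 1#
  N v i (suc zero) = v i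

  -- indices 0,1,2 stand for the paper's 1,2,3
  p₀ : (x : Fin 3 → A) → A → A
  p₀ x L = sq (x zero) + sq (x (suc zero)) + sq (x (suc (suc zero))) - sq L

  p : (x d : Fin 3 → A) → Fin 3 → A
  p x d zero = sq (x (suc zero)) + sq (x (suc (suc zero))) - sq (d zero)
  p x d (suc zero) = sq (x (suc (suc zero))) + sq (x zero) - sq (d (suc zero))
  p x d (suc (suc zero)) = sq (x zero) + sq (x (suc zero)) - sq (d (suc (suc zero)))

  Σ₃ : (Fin 3 → A) → A
  Σ₃ f = f zero + f (suc zero) + f (suc (suc zero))

  pt₁ pt₂ pt₃ pt₄ pt₅ pt₆ pt₇ pt₈ : (x d : Fin 3 → A) → A → A
  pt₁ x d L = p₀ x L
  pt₂ x d L = Σ₃ (λ i → p x d i)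
  pt₃ x d L = Σ₃ (λ i → d i * p x d i)
  pt₄ x d L = Σ₃ (λ i → x i * p x d i)
  pt₅ x d L = Σ₃ (λ i → x i * d i * p x d i)
  pt₆ x d L = Σ₃ (λ i → sq (x i) * p x d i)
  pt₇ x d L = Σ₃ (λ i → sq (d i) * p x d i)
  pt₈ x d L = Σ₃ (λ i → sq (x i) * sq (d i) * p x d i)

  RankCond : (x d : Fin 3 → A) → Set
  RankCond x d = rank (N d) ≡ 1 × rank (N x) ≡ 2

  FactorEqs : (x d : Fin 3 → A) → A → Set
  FactorEqs x d L =
    pt₁ x d L ≡ 0# × pt₂ x d L ≡ 0# × pt₃ x d L ≡ 0# × pt₄ x d L ≡ 0# ×
    pt₅ x d L ≡ 0# × pt₆ x d L ≡ 0# × pt₇ x d L ≡ 0# × pt₈ x d L ≡ 0#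

  PEqs : (x d : Fin 3 → A) → A → Set
  PEqs x d L = p₀ x L ≡ 0# × p x d zero ≡ 0# × p x d (suc zero) ≡ 0# × p x d (suc (suc zero)) ≡ 0#

  NoFactorSolution : Set
  NoFactorSolution =
    ¬ (Σ (Fin 3 → A) λ x → Σ (Fin 3 → A) λ d → Σ A λ L → RankCond x d × FactorEqs x d L)

  NoPSolution : Set
  NoPSolution =
    ¬ (Σ (Fin 3 → A) λ x → Σ (Fin 3 → A) λ d → Σ A λ L → RankCond x d × PEqs x d L)

module OverZ = Generic ℤ.0ℤ ℤ.1ℤ ℤ._+_ ℤ._*_ ℤ._-_ ℤP._≟_
module OverQ = Generic ℚ.0ℚ ℚ.1ℚ ℚ._+_ ℚ._*_ ℚ._-_ ℚP._≟_

{-# OPTIONS --safe #-}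
module Submission where

-- Rank N₁ = 1 forces d₁ = d₂ = d₃ =: d, and then p₁ + p₂ + p₃ = 2(x₁² + x₂² + x₃²) − 3d²,
-- which is 2L² − 3d² once p₀ = 0. So both systems give 2L² = 3d². As 3/2 is not a rational
-- square (3-adic descent), L = 0; then x₁² + x₂² + x₃² = 0 gives x = 0, and N₂ has rank ≤ 1.

open import Algebra.Structures using (IsCommutativeRing)
import Data.Integer.Properties as ℤP
open import Data.Product using (∃₂; _×_; _,_)
import Data.Rational.Properties as ℚP
open import Relation.Binary.Definitions using (DecidableEquality)
open import Relation.Binary.PropositionalEquality
open import Defs

module OverCommutativeRing
  {A : Set} {add mul : A → A → A} {neg : A → A} {0# 1# : A}
  (isCommutativeRing : IsCommutativeRing _≡_ add mul neg 0# 1#)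
  (_≟_ : DecidableEquality A) where

  open import Algebra.Bundles using (CommutativeRing)
  import Algebra.Properties.AbelianGroup as AbelianGroupProperties
  import Algebra.Properties.Group as GroupProperties
  import Algebra.Solver.CommutativeMonoid as CommutativeMonoidSolver
  open import Data.Bool using (true; false; if_then_else_)
  open import Data.Empty using (⊥; ⊥-elim)
  open import Data.Fin using (Fin; zero; suc)
  open import Relation.Nullary using (yes; no)

  private
    R : CommutativeRing _ _
    R = record { isCommutativeRing = isCommutativeRing }
  open CommutativeRing R using
    (_-_; +-abelianGroup; +-group; +-commutativeMonoid; +-identityʳ; -‿inverseʳ; *-identityˡ; *-identityʳ; zeroˡ)
  open Generic 0# 1# add mul _-_ _≟_ hiding (_-_)

  x-y≡0⇒x≡y : ∀ {a b} → a - b ≡ 0# → a ≡ b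
  x-y≡0⇒x≡y = GroupProperties.x∙y⁻¹≈ε⇒x≈y +-group _ _

  if-then-1-else-0≢2 : ∀ b → (if b then 1 else 0) ≢ 2
  if-then-1-else-0≢2 true ()
  if-then-1-else-0≢2 false ()

  rank≢2⇒minors≡0 : ∀ M → rank M ≢ 2 →
                    minor M zero (suc zero) ≡ 0# × minor M zero (suc (suc zero)) ≡ 0#
  rank≢2⇒minors≡0 M rank≢2 with minor M zero (suc zero) ≟ 0# | minor M zero (suc (suc zero)) ≟ 0#
  ... | yes m₀₁≡0 | yes m₀₂≡0 = m₀₁≡0 , m₀₂≡0
  ... | no _      | _         = ⊥-elim (rank≢2 refl)
  ... | yes _     | no _      = ⊥-elim (rank≢2 refl)

  minors≡0⇒rank≢2 : ∀ M → minor M zero (suc zero) ≡ 0# → minor M zero (suc (suc zero)) ≡ 0# →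
                    minor M (suc zero) (suc (suc zero)) ≡ 0# → rank M ≢ 2
  minors≡0⇒rank≢2 M m₀₁≡0 m₀₂≡0 m₁₂≡0
    with minor M zero (suc zero) ≟ 0# | minor M zero (suc (suc zero)) ≟ 0#
       | minor M (suc zero) (suc (suc zero)) ≟ 0#
  ... | yes _    | yes _    | yes _    = if-then-1-else-0≢2 _
  ... | no m₀₁≢0 | _        | _        = ⊥-elim (m₀₁≢0 m₀₁≡0)
  ... | yes _    | no m₀₂≢0 | _        = ⊥-elim (m₀₂≢0 m₀₂≡0)
  ... | yes _    | yes _    | no m₁₂≢0 = ⊥-elim (m₁₂≢0 m₁₂≡0)

  minor-N : ∀ v i k → minor (N v) i k ≡ v k - v i
  minor-N v i k = cong₂ _-_ (*-identityˡ (v k)) (*-identityʳ (v i))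

  rank-N≡1⇒constant : ∀ v → rank (N v) ≡ 1 → v (suc zero) ≡ v zero × v (suc (suc zero)) ≡ v zero
  rank-N≡1⇒constant v rank≡1 =
    let m₀₁≡0 , m₀₂≡0 = rank≢2⇒minors≡0 (N v) rank≢2
    in x-y≡0⇒x≡y (trans (sym (minor-N v _ _)) m₀₁≡0) , x-y≡0⇒x≡y (trans (sym (minor-N v _ _)) m₀₂≡0)
    where
    rank≢2 : rank (N v) ≢ 2
    rank≢2 rank≡2 with () ← trans (sym rank≡1) rank≡2

  constant⇒rank-N≢2 : ∀ v → v (suc zero) ≡ v zero → v (suc (suc zero)) ≡ v zero → rank (N v) ≢ 2
  constant⇒rank-N≢2 v v₁≡v₀ v₂≡v₀ =
    minors≡0⇒rank≢2 (N v) (vanishes v₁≡v₀) (vanishes v₂≡v₀) (vanishes (trans v₂≡v₀ (sym v₁≡v₀)))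
    where
    vanishes : ∀ {i k} → v k ≡ v i → minor (N v) i k ≡ 0#
    vanishes {i} {k} vk≡vi = trans (minor-N v i k) (trans (cong (_- v i) vk≡vi) (-‿inverseʳ (v i)))

  normSq : (Fin 3 → A) → A
  normSq x = Σ₃ (λ i → sq (x i))

  Σp≡2normSq-normSq : ∀ x d → Σ₃ (p x d) ≡ (normSq x + normSq x) - normSq d
  Σp≡2normSq-normSq x d = begin
    Σ₃ (p x d)
      ≡⟨ solve 6 (λ a b c u v w →
                   (((b ⊕ c) ⊕ u) ⊕ ((c ⊕ a) ⊕ v)) ⊕ ((a ⊕ b) ⊕ w) ⊜
                   (((a ⊕ b) ⊕ c) ⊕ ((a ⊕ b) ⊕ c)) ⊕ ((u ⊕ v) ⊕ w)) refl
                 (sq (x zero)) (sq (x (suc zero))) (sq (x (suc (suc zero))))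
                 (neg (sq (d zero))) (neg (sq (d (suc zero)))) (neg (sq (d (suc (suc zero))))) ⟩
    (normSq x + normSq x) + ((neg (sq (d zero)) + neg (sq (d (suc zero)))) + neg (sq (d (suc (suc zero)))))
      ≡⟨ cong ((normSq x + normSq x) +_) neg-normSq ⟨
    (normSq x + normSq x) - normSq d ∎
    where
    open ≡-Reasoning
    -- The identity is linear in the squares, so a commutative-monoid solver suffices.
    open CommutativeMonoidSolver +-commutativeMonoid
    neg-+ : ∀ a b → neg (a + b) ≡ neg a + neg b
    neg-+ a b = sym (AbelianGroupProperties.⁻¹-∙-comm +-abelianGroup a b)
    neg-normSq : neg (normSq d) ≡ (neg (sq (d zero)) + neg (sq (d (suc zero)))) + neg (sq (d (suc (suc zero))))
    neg-normSq = trans (neg-+ _ _) (cong (_+ neg (sq (d (suc (suc zero))))) (neg-+ _ _))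

  ThreeHalvesNonSquare : Set
  ThreeHalvesNonSquare = ∀ L d → sq L + sq L ≡ sq d + sq d + sq d → L ≡ 0#

  SumOfThreeSquaresAnisotropic : Set
  SumOfThreeSquaresAnisotropic = ∀ a b c → sq a + sq b + sq c ≡ 0# → a ≡ 0# × b ≡ 0# × c ≡ 0#

  module _ (threeHalvesNonSquare : ThreeHalvesNonSquare)
           (anisotropic : SumOfThreeSquaresAnisotropic) where

    no-solution : ∀ x d L → RankCond x d → p₀ x L ≡ 0# → Σ₃ (p x d) ≡ 0# → ⊥
    no-solution x d L (rank-Nd≡1 , rank-Nx≡2) p₀≡0 Σp≡0 =
      let x₀≡0 , x₁≡0 , x₂≡0 = anisotropic (x zero) (x (suc zero)) (x (suc (suc zero))) normSq≡0
      in constant⇒rank-N≢2 x (trans x₁≡0 (sym x₀≡0)) (trans x₂≡0 (sym x₀≡0)) rank-Nx≡2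
      where
      open ≡-Reasoning
      normSq≡L² : normSq x ≡ sq L
      normSq≡L² = x-y≡0⇒x≡y p₀≡0
      2L²≡3d₀² : sq L + sq L ≡ sq (d zero) + sq (d zero) + sq (d zero)
      2L²≡3d₀² = let d₁≡d₀ , d₂≡d₀ = rank-N≡1⇒constant d rank-Nd≡1 in begin
        sq L + sq L                              ≡⟨ cong₂ _+_ normSq≡L² normSq≡L² ⟨
        normSq x + normSq x                      ≡⟨ x-y≡0⇒x≡y (trans (sym (Σp≡2normSq-normSq x d)) Σp≡0) ⟩
        normSq d                                 ≡⟨ cong₂ (λ u v → sq (d zero) + sq u + sq v) d₁≡d₀ d₂≡d₀ ⟩
        sq (d zero) + sq (d zero) + sq (d zero)  ∎
      normSq≡0 : normSq x ≡ 0#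
      normSq≡0 = begin
        normSq x  ≡⟨ normSq≡L² ⟩
        sq L      ≡⟨ cong sq (threeHalvesNonSquare L (d zero) 2L²≡3d₀²) ⟩
        sq 0#     ≡⟨ zeroˡ 0# ⟩
        0#        ∎

    noFactorSolution : NoFactorSolution
    noFactorSolution (x , d , L , rankCond , pt₁≡0 , pt₂≡0 , _) = no-solution x d L rankCond pt₁≡0 pt₂≡0

    noPSolution : NoPSolution
    noPSolution (x , d , L , rankCond , p₀≡0 , p₁≡0 , p₂≡0 , p₃≡0) =
      no-solution x d L rankCond p₀≡0 (begin
        Σ₃ (p x d)    ≡⟨ cong₂ _+_ (cong₂ _+_ p₁≡0 p₂≡0) p₃≡0 ⟩
        0# + 0# + 0#  ≡⟨ trans (+-identityʳ _) (+-identityʳ _) ⟩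
        0#            ∎)
      where open ≡-Reasoning

module ThreeHalvesDescent where

  open import Data.List using ([]; _∷_)
  open import Data.Nat using (zero; suc; _*_; _<_; s≤s; z≤n)
  open import Data.Nat.Coprimality using (coprime?; coprime-divisor)
  open import Data.Nat.Divisibility using (_∣_; divides)
  open import Data.Nat.Induction using (<-wellFounded)
  open import Data.Nat.Primality using (prime?; euclidsLemma)
  open import Data.Nat.Properties using (*-comm; *-cancelˡ-≡; m<m*n)
  open import Data.Nat.Tactic.RingSolver using (solve)
  open import Data.Sum using (reduce)
  open import Induction.WellFounded using (Acc; acc)
  open import Relation.Nullary.Decidable using (from-yes)
  open ≡-Reasoning

  3∣n²⇒3∣n : ∀ n → 3 ∣ n * n → 3 ∣ n
  3∣n²⇒3∣n n 3∣n² = reduce (euclidsLemma n n (from-yes (prime? 3)) 3∣n²)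

  3∣2n⇒3∣n : ∀ n → 3 ∣ 2 * n → 3 ∣ n
  3∣2n⇒3∣n n = coprime-divisor (from-yes (coprime? 3 2))

  2m²≡3n²⇒3∣m : ∀ m n → 2 * (m * m) ≡ 3 * (n * n) → 3 ∣ m
  2m²≡3n²⇒3∣m m n 2m²≡3n² =
    3∣n²⇒3∣n m (3∣2n⇒3∣n (m * m) (divides (n * n) (trans 2m²≡3n² (*-comm 3 (n * n)))))

  2[3k]²≡3n²⇒3∣n : ∀ k n → 2 * (k * 3 * (k * 3)) ≡ 3 * (n * n) → 3 ∣ n
  2[3k]²≡3n²⇒3∣n k n 2[3k]²≡3n² = 3∣n²⇒3∣n n (divides (2 * (k * k)) (*-cancelˡ-≡ _ _ 3 (begin
    3 * (n * n)             ≡⟨ 2[3k]²≡3n² ⟨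
    2 * (k * 3 * (k * 3))   ≡⟨ solve (k ∷ []) ⟩
    3 * (2 * (k * k) * 3)   ∎)))

  2m²≡3n²⇒2[m/3]²≡3[n/3]² : ∀ m n → 2 * (m * m) ≡ 3 * (n * n) →
                   ∃₂ λ k j → m ≡ k * 3 × 2 * (k * k) ≡ 3 * (j * j)
  2m²≡3n²⇒2[m/3]²≡3[n/3]² m n 2m²≡3n²
    with divides k refl ← 2m²≡3n²⇒3∣m m n 2m²≡3n²
    with divides j refl ← 2[3k]²≡3n²⇒3∣n k n 2m²≡3n²
    = k , j , refl , *-cancelˡ-≡ _ _ 9 (begin
        9 * (2 * (k * k))       ≡⟨ solve (k ∷ []) ⟩
        2 * (k * 3 * (k * 3))   ≡⟨ 2m²≡3n² ⟩
        3 * (j * 3 * (j * 3))   ≡⟨ solve (j ∷ []) ⟩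
        9 * (3 * (j * j))       ∎)

  2m²≡3n²⇒m≡0 : ∀ m n → 2 * (m * m) ≡ 3 * (n * n) → m ≡ 0
  2m²≡3n²⇒m≡0 m = descent (<-wellFounded m)
    where
    descent : ∀ {m} → Acc _<_ m → ∀ n → 2 * (m * m) ≡ 3 * (n * n) → m ≡ 0
    descent {zero}  _             _ _       = refl
    descent {suc _} (acc smaller) n 2m²≡3n² with 2m²≡3n²⇒2[m/3]²≡3[n/3]² _ n 2m²≡3n²
    ... | zero  , _ , () , _
    ... | suc k , j , m≡k*3 , 2k²≡3j² =
      trans m≡k*3 (cong (_* 3) (descent (smaller k<m) j 2k²≡3j²))
      where
      k<m : suc k < _
      k<m = subst (suc k <_) (sym m≡k*3) (m<m*n (suc k) 3 (s≤s (s≤s z≤n)))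

module OverInteger where

  open import Data.Integer using (+_; -[1+_]; ∣_∣; 0ℤ; _+_; _*_)
  open import Data.Integer.Properties using (+◃n≡+n; pos-+; +-injective; ∣i∣≡0⇒i≡0)
  import Data.Nat as ℕ
  open import Data.Nat.Tactic.RingSolver using (solve-∀)
  open ThreeHalvesDescent using (2m²≡3n²⇒m≡0)
  open ≡-Reasoning

  i*i≡+∣i∣² : ∀ i → i * i ≡ + (∣ i ∣ ℕ.* ∣ i ∣)
  i*i≡+∣i∣² (+ n)    = +◃n≡+n (n ℕ.* n)
  i*i≡+∣i∣² -[1+ n ] = refl

  +-of-pos : ∀ {u v m n} → u ≡ + m → v ≡ + n → u + v ≡ + (m ℕ.+ n)
  +-of-pos {m = m} {n} refl refl = sym (pos-+ m n)

  threeHalvesNonSquare : ∀ L d → L * L + L * L ≡ d * d + d * d + d * d → L ≡ 0ℤ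
  threeHalvesNonSquare L d 2L²≡3d² = ∣i∣≡0⇒i≡0 (2m²≡3n²⇒m≡0 l m (begin
    2 ℕ.* (l ℕ.* l)                   ≡⟨ twice (l ℕ.* l) ⟩
    l ℕ.* l ℕ.+ l ℕ.* l               ≡⟨ +-injective (begin
      + (l ℕ.* l ℕ.+ l ℕ.* l)               ≡⟨ +-of-pos (i*i≡+∣i∣² L) (i*i≡+∣i∣² L) ⟨
      L * L + L * L                         ≡⟨ 2L²≡3d² ⟩
      d * d + d * d + d * d                 ≡⟨ +-of-pos (+-of-pos (i*i≡+∣i∣² d) (i*i≡+∣i∣² d)) (i*i≡+∣i∣² d) ⟩
      + (m ℕ.* m ℕ.+ m ℕ.* m ℕ.+ m ℕ.* m)   ∎) ⟩
    m ℕ.* m ℕ.+ m ℕ.* m ℕ.+ m ℕ.* m   ≡⟨ thrice (m ℕ.* m) ⟩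
    3 ℕ.* (m ℕ.* m)                   ∎))
    where
    l m : ℕ.ℕ
    l = ∣ L ∣
    m = ∣ d ∣
    twice : ∀ n → 2 ℕ.* n ≡ n ℕ.+ n
    twice = solve-∀
    thrice : ∀ n → n ℕ.+ n ℕ.+ n ≡ 3 ℕ.* n
    thrice = solve-∀

  ℕ-sum-of-squares≡0 : ∀ a b c → a ℕ.* a ℕ.+ b ℕ.* b ℕ.+ c ℕ.* c ≡ 0 → a ≡ 0 × b ≡ 0 × c ≡ 0
  ℕ-sum-of-squares≡0 ℕ.zero     ℕ.zero     ℕ.zero     _  = refl , refl , refl
  ℕ-sum-of-squares≡0 (ℕ.suc _)  _          _          ()
  ℕ-sum-of-squares≡0 ℕ.zero     (ℕ.suc _)  _          ()
  ℕ-sum-of-squares≡0 ℕ.zero     ℕ.zero     (ℕ.suc _)  ()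

  anisotropic : ∀ a b c → a * a + b * b + c * c ≡ 0ℤ → a ≡ 0ℤ × b ≡ 0ℤ × c ≡ 0ℤ
  anisotropic a b c a²+b²+c²≡0 =
    let ∣a∣≡0 , ∣b∣≡0 , ∣c∣≡0 = ℕ-sum-of-squares≡0 _ _ _ (+-injective (trans
          (sym (+-of-pos (+-of-pos (i*i≡+∣i∣² a) (i*i≡+∣i∣² b)) (i*i≡+∣i∣² c))) a²+b²+c²≡0))
    in ∣i∣≡0⇒i≡0 ∣a∣≡0 , ∣i∣≡0⇒i≡0 ∣b∣≡0 , ∣i∣≡0⇒i≡0 ∣c∣≡0

module OverRational where

  open import Data.Integer as ℤ using (ℤ; +_; 0ℤ)
  open import Data.Integer.Tactic.RingSolver using (solve-∀)
  import Data.Nat as ℕ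
  open import Data.Rational using (mkℚ; 0ℚ; ↥_; ↧_; toℚᵘ; _+_; _*_)
  open import Data.Rational.Properties using (↥p≡0⇒p≡0; toℚᵘ-homo-+; toℚᵘ-homo-*; toℚᵘ-cong)
  import Data.Rational.Unnormalised as ℚᵘ
  open import Data.Rational.Unnormalised.Properties using (≃-trans; ≃-sym; +-cong; drop-*≡*)

  ↥p*pos≡0⇒p≡0 : ∀ p k → ↥ p ℤ.* + ℕ.suc k ≡ 0ℤ → p ≡ 0ℚ
  ↥p*pos≡0⇒p≡0 p k ↥p*k≡0 =
    ↥p≡0⇒p≡0 p (ℤP.*-cancelʳ-≡ (↥ p) 0ℤ (+ ℕ.suc k) (trans ↥p*k≡0 (sym (ℤP.*-zeroˡ (+ ℕ.suc k)))))

  toℚᵘ-+ : ∀ {p q u v} → toℚᵘ p ℚᵘ.≃ u → toℚᵘ q ℚᵘ.≃ v → toℚᵘ (p + q) ℚᵘ.≃ u ℚᵘ.+ v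
  toℚᵘ-+ {p} {q} p≃u q≃v = ≃-trans (toℚᵘ-homo-+ p q) (+-cong p≃u q≃v)

  toℚᵘ-sq : ∀ p → toℚᵘ (p * p) ℚᵘ.≃ toℚᵘ p ℚᵘ.* toℚᵘ p
  toℚᵘ-sq p = toℚᵘ-homo-* p p

  -- With L = n/U and d = m/V, the integers X = n U V³ and Y = m V² U² satisfy 2X² = 3Y².
  threeHalvesNonSquare : ∀ L d → L * L + L * L ≡ d * d + d * d + d * d → L ≡ 0ℚ
  threeHalvesNonSquare L@(mkℚ n _ _) d@(mkℚ m _ _) 2L²≡3d² =
    ↥p*pos≡0⇒p≡0 L _ (OverInteger.threeHalvesNonSquare (n ℤ.* (U ℤ.* V ℤ.* V ℤ.* V)) (m ℤ.* (V ℤ.* V ℤ.* U ℤ.* U))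
                        (cleared n U m V (drop-*≡* 2L²≃3d²)))
    where
    U V : ℤ
    U = ↧ L
    V = ↧ d
    2L²≃3d² : toℚᵘ L ℚᵘ.* toℚᵘ L ℚᵘ.+ toℚᵘ L ℚᵘ.* toℚᵘ L
              ℚᵘ.≃ toℚᵘ d ℚᵘ.* toℚᵘ d ℚᵘ.+ toℚᵘ d ℚᵘ.* toℚᵘ d ℚᵘ.+ toℚᵘ d ℚᵘ.* toℚᵘ d
    2L²≃3d² = ≃-trans (≃-sym (toℚᵘ-+ (toℚᵘ-sq L) (toℚᵘ-sq L)))
                (≃-trans (toℚᵘ-cong 2L²≡3d²) (toℚᵘ-+ (toℚᵘ-+ (toℚᵘ-sq d) (toℚᵘ-sq d)) (toℚᵘ-sq d)))
    cleared : ∀ n U m V →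
              (n ℤ.* n ℤ.* (U ℤ.* U) ℤ.+ n ℤ.* n ℤ.* (U ℤ.* U)) ℤ.* ((V ℤ.* V) ℤ.* (V ℤ.* V) ℤ.* (V ℤ.* V))
                ≡ ((m ℤ.* m ℤ.* (V ℤ.* V) ℤ.+ m ℤ.* m ℤ.* (V ℤ.* V)) ℤ.* (V ℤ.* V) ℤ.+ m ℤ.* m ℤ.* ((V ℤ.* V) ℤ.* (V ℤ.* V)))
                    ℤ.* ((U ℤ.* U) ℤ.* (U ℤ.* U)) →
              let X = n ℤ.* (U ℤ.* V ℤ.* V ℤ.* V) ; Y = m ℤ.* (V ℤ.* V ℤ.* U ℤ.* U) in
              X ℤ.* X ℤ.+ X ℤ.* X ≡ Y ℤ.* Y ℤ.+ Y ℤ.* Y ℤ.+ Y ℤ.* Y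
    cleared n U m V cross = trans (lhs n U V) (trans cross (rhs m U V))
      where
      lhs : ∀ n U V → let X = n ℤ.* (U ℤ.* V ℤ.* V ℤ.* V) in
            X ℤ.* X ℤ.+ X ℤ.* X ≡ (n ℤ.* n ℤ.* (U ℤ.* U) ℤ.+ n ℤ.* n ℤ.* (U ℤ.* U)) ℤ.* ((V ℤ.* V) ℤ.* (V ℤ.* V) ℤ.* (V ℤ.* V))
      lhs = solve-∀
      rhs : ∀ m U V → let Y = m ℤ.* (V ℤ.* V ℤ.* U ℤ.* U) in
            ((m ℤ.* m ℤ.* (V ℤ.* V) ℤ.+ m ℤ.* m ℤ.* (V ℤ.* V)) ℤ.* (V ℤ.* V) ℤ.+ m ℤ.* m ℤ.* ((V ℤ.* V) ℤ.* (V ℤ.* V)))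
              ℤ.* ((U ℤ.* U) ℤ.* (U ℤ.* U)) ≡ Y ℤ.* Y ℤ.+ Y ℤ.* Y ℤ.+ Y ℤ.* Y
      rhs = solve-∀

  anisotropic : ∀ a b c → a * a + b * b + c * c ≡ 0ℚ → a ≡ 0ℚ × b ≡ 0ℚ × c ≡ 0ℚ
  anisotropic a@(mkℚ n₀ _ _) b@(mkℚ n₁ _ _) c@(mkℚ n₂ _ _) a²+b²+c²≡0 =
    let X₀≡0 , X₁≡0 , X₂≡0 = OverInteger.anisotropic (n₀ ℤ.* (U₁ ℤ.* U₂)) (n₁ ℤ.* (U₀ ℤ.* U₂)) (n₂ ℤ.* (U₀ ℤ.* U₁))
                                (trans (cleared n₀ n₁ n₂ U₀ U₁ U₂) (drop-*≡* a²+b²+c²≃0))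
    in ↥p*pos≡0⇒p≡0 a _ X₀≡0 , ↥p*pos≡0⇒p≡0 b _ X₁≡0 , ↥p*pos≡0⇒p≡0 c _ X₂≡0
    where
    U₀ U₁ U₂ : ℤ
    U₀ = ↧ a
    U₁ = ↧ b
    U₂ = ↧ c
    a²+b²+c²≃0 : toℚᵘ a ℚᵘ.* toℚᵘ a ℚᵘ.+ toℚᵘ b ℚᵘ.* toℚᵘ b ℚᵘ.+ toℚᵘ c ℚᵘ.* toℚᵘ c ℚᵘ.≃ ℚᵘ.0ℚᵘ
    a²+b²+c²≃0 = ≃-trans (≃-sym (toℚᵘ-+ (toℚᵘ-+ (toℚᵘ-sq a) (toℚᵘ-sq b)) (toℚᵘ-sq c))) (toℚᵘ-cong a²+b²+c²≡0)
    cleared : ∀ n₀ n₁ n₂ U₀ U₁ U₂ →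
              let X₀ = n₀ ℤ.* (U₁ ℤ.* U₂) ; X₁ = n₁ ℤ.* (U₀ ℤ.* U₂) ; X₂ = n₂ ℤ.* (U₀ ℤ.* U₁) in
              X₀ ℤ.* X₀ ℤ.+ X₁ ℤ.* X₁ ℤ.+ X₂ ℤ.* X₂
                ≡ ((n₀ ℤ.* n₀ ℤ.* (U₁ ℤ.* U₁) ℤ.+ n₁ ℤ.* n₁ ℤ.* (U₀ ℤ.* U₀)) ℤ.* (U₂ ℤ.* U₂)
                    ℤ.+ n₂ ℤ.* n₂ ℤ.* ((U₀ ℤ.* U₀) ℤ.* (U₁ ℤ.* U₁))) ℤ.* ℤ.1ℤ
    cleared = solve-∀

theorem5p2 : (OverZ.NoFactorSolution × OverQ.NoFactorSolution)
           × (OverZ.NoPSolution × OverQ.NoPSolution)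
theorem5p2 =
    ( overℤ.noFactorSolution OverInteger.threeHalvesNonSquare OverInteger.anisotropic
    , overℚ.noFactorSolution OverRational.threeHalvesNonSquare OverRational.anisotropic )
  , ( overℤ.noPSolution OverInteger.threeHalvesNonSquare OverInteger.anisotropic
    , overℚ.noPSolution OverRational.threeHalvesNonSquare OverRational.anisotropic )
  where
  module overℤ = OverCommutativeRing ℤP.+-*-isCommutativeRing ℤP._≟_
  module overℚ = OverCommutativeRing ℚP.+-*-isCommutativeRing ℚP._≟_
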